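{- Let $(a_n)_{n\ge1}$ be defined by $a_1=1$ and $a_n=a_{n-1}+a_{\lfloor n/2\rfloor}$ for $n>1$. For a positive integer $n$, let $2^r$ be the largest power of $2$ dividing $n$. Then $a_n\equiv r+1\pmod 2$; in particular the parity of $a_n$ depends only on the parity of $r$. -}

module Defs where

-- Subtracting the two recurrences at indices 2m and 2m + 1 gives
-- a(2m + 1) = a(2m − 1) + 2 a(m), so a is odd at every odd index, starting from
-- a(1) = 1.  Then a(2m) = a(2m − 1) + a(m) ≡ 1 + a(m) (mod 2): each factor 2 of
-- n flips the parity, and writing n = 2^r (2k + 1) gives a(n) ≡ r + 1.
module Submission where

open import Defs
open import Data.Nat using (ℕ; suc; _+_; _∸_; _^_; _/_; _%_; _<_; _≤_)
open import Data.Nat.Divisibility using (_∣_)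
open import Relation.Binary.PropositionalEquality using (_≡_)
open import Relation.Nullary using (¬_)

open import Data.Nat using (zero; _*_; NonZero; s≤s; z≤n)
open import Data.Nat.Properties using (*-assoc; *-comm; *-identityʳ; +-identityʳ; +-assoc; m*n≢0; m^n≢0)
open import Data.Nat.DivMod
  using (%-distribˡ-+; [m+kn]%n≡m%n; m*n/n≡m; +-distrib-/-∣ʳ; _divMod_; result)
open import Data.Nat.Divisibility using (divides; divides-refl)
open import Data.Fin using (zero; suc)
open import Data.Product using (∃-syntax; _,_)
open import Data.Empty using (⊥-elim)
open import Relation.Binary.PropositionalEquality using (refl; sym; trans; cong; cong₂; module ≡-Reasoning)

%-cong-+ : ∀ d .{{_ : NonZero d}} x y u v →
           x % d ≡ u % d → y % d ≡ v % d → (x + y) % d ≡ (u + v) % d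
%-cong-+ d x y u v x≡u y≡v = begin
  (x + y) % d         ≡⟨ %-distribˡ-+ x y d ⟩
  (x % d + y % d) % d ≡⟨ cong₂ (λ p q → (p + q) % d) x≡u y≡v ⟩
  (u % d + v % d) % d ≡⟨ %-distribˡ-+ u v d ⟨
  (u + v) % d         ∎
  where open ≡-Reasoning

x+x≡x*2 : ∀ x → x + x ≡ x * 2
x+x≡x*2 x = trans (cong (x +_) (sym (+-identityʳ x))) (*-comm 2 x)

[1+m*2]/2≡m : ∀ m → suc (m * 2) / 2 ≡ m
[1+m*2]/2≡m m = trans (+-distrib-/-∣ʳ 1 {m * 2} (divides-refl m)) (m*n/n≡m m 2)

odd-cofactor : ∀ {n} r → 2 ^ r ∣ n → ¬ (2 ^ suc r ∣ n) → ∃[ k ] n ≡ suc (k * 2) * 2 ^ r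
odd-cofactor {n} r (divides q n≡q*2^r) 2^1+r∤n with q divMod 2
... | result k zero q≡k*2 = ⊥-elim (2^1+r∤n (divides k (begin
  n             ≡⟨ n≡q*2^r ⟩
  q * 2 ^ r     ≡⟨ cong (_* 2 ^ r) q≡k*2 ⟩
  k * 2 * 2 ^ r ≡⟨ *-assoc k 2 (2 ^ r) ⟩
  k * 2 ^ suc r ∎)))
  where open ≡-Reasoning
... | result k (suc zero) q≡1+k*2 = k , trans n≡q*2^r (cong (_* 2 ^ r) q≡1+k*2)

module _ (a : ℕ → ℕ) (a-1 : a 1 ≡ 1)
         (a-rec : ∀ n → 1 < n → a n ≡ a (n ∸ 1) + a (n / 2)) where

  a-even : ∀ m → a (suc m * 2) ≡ a (suc (m * 2)) + a (suc m)
  a-even m = trans (a-rec (suc m * 2) (s≤s (s≤s z≤n)))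
                   (cong (λ i → a (suc (m * 2)) + a i) (m*n/n≡m (suc m) 2))

  a-odd : ∀ m → a (suc (suc m * 2)) ≡ a (suc m * 2) + a (suc m)
  a-odd m = trans (a-rec (suc (suc m * 2)) (s≤s (s≤s z≤n)))
                  (cong (λ i → a (suc m * 2) + a i) ([1+m*2]/2≡m (suc m)))

  a-odd-index : ∀ m → a (suc (m * 2)) % 2 ≡ 1
  a-odd-index zero = cong (_% 2) a-1
  a-odd-index (suc m) = begin
    a (suc (suc m * 2)) % 2               ≡⟨ cong (_% 2) a[2m+3]≡a[2m+1]+2a[m+1] ⟩
    (a (suc (m * 2)) + a (suc m) * 2) % 2 ≡⟨ [m+kn]%n≡m%n (a (suc (m * 2))) (a (suc m)) 2 ⟩
    a (suc (m * 2)) % 2                   ≡⟨ a-odd-index m ⟩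
    1                                     ∎
    where
    open ≡-Reasoning
    a[2m+3]≡a[2m+1]+2a[m+1] : a (suc (suc m * 2)) ≡ a (suc (m * 2)) + a (suc m) * 2
    a[2m+3]≡a[2m+1]+2a[m+1] = begin
      a (suc (suc m * 2))                        ≡⟨ a-odd m ⟩
      a (suc m * 2) + a (suc m)                  ≡⟨ cong (_+ a (suc m)) (a-even m) ⟩
      a (suc (m * 2)) + a (suc m) + a (suc m)    ≡⟨ +-assoc (a (suc (m * 2))) (a (suc m)) (a (suc m)) ⟩
      a (suc (m * 2)) + (a (suc m) + a (suc m))  ≡⟨ cong (a (suc (m * 2)) +_) (x+x≡x*2 (a (suc m))) ⟩
      a (suc (m * 2)) + a (suc m) * 2            ∎

  a-double : ∀ m .{{_ : NonZero m}} → a (m * 2) % 2 ≡ suc (a m) % 2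
  a-double (suc m) = trans (cong (_% 2) (a-even m))
    (%-cong-+ 2 (a (suc (m * 2))) (a (suc m)) 1 (a (suc m)) (a-odd-index m) refl)

  a-parity : ∀ r k → a (suc (k * 2) * 2 ^ r) % 2 ≡ (r + 1) % 2
  a-parity zero k = trans (cong (λ i → a i % 2) (*-identityʳ (suc (k * 2)))) (a-odd-index k)
  a-parity (suc r) k = begin
    a (o * 2 ^ suc r) % 2   ≡⟨ cong (λ i → a i % 2) o*2^[1+r]≡o*2^r*2 ⟩
    a (o * 2 ^ r * 2) % 2   ≡⟨ a-double (o * 2 ^ r) ⟩
    suc (a (o * 2 ^ r)) % 2 ≡⟨ %-cong-+ 2 1 (a (o * 2 ^ r)) 1 (r + 1) refl (a-parity r k) ⟩
    (suc r + 1) % 2         ∎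
    where
    open ≡-Reasoning
    o : ℕ
    o = suc (k * 2)
    o*2^[1+r]≡o*2^r*2 : o * 2 ^ suc r ≡ o * 2 ^ r * 2
    o*2^[1+r]≡o*2^r*2 = trans (cong (o *_) (*-comm 2 (2 ^ r))) (sym (*-assoc o (2 ^ r) 2))
    instance
      _ : NonZero (o * 2 ^ r)
      _ = m*n≢0 o (2 ^ r) {{_}} {{m^n≢0 2 r}}

mainTheorem2 : (a : ℕ → ℕ) → a 1 ≡ 1
    → (∀ n → 1 < n → a n ≡ a (n ∸ 1) + a (n / 2))
    → ∀ n r → 1 ≤ n → 2 ^ r ∣ n → ¬ (2 ^ suc r ∣ n)
    → a n % 2 ≡ (r + 1) % 2
-- The hypothesis 1 ≤ n is redundant: 2 ^ suc r divides 0.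
mainTheorem2 a a-1 a-rec n r _ 2^r∣n 2^1+r∤n with odd-cofactor r 2^r∣n 2^1+r∤n
... | k , refl = a-parity a a-1 a-rec r k
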